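{- Suppose $f:\mathbb{N}\to\mathbb{N}^+$ satisfies $\lim_{n\to\infty}f(n)=\infty$, and let $g(x)=\left\lfloor\frac{\lg x}{f(x)\lg\lg x}\right\rfloor$ for $x\ge4$ and $g(x)=0$ for $x<4$. Then for every $k$ there exists $N$ such that $N\longrightarrow(k)^2_g$.
   Context: $\lg$ is the base-2 logarithm. A natural number $N$ is identified with $\{0,1,\dots,N-1\}$, and $[X]^2$ denotes the set of two-element subsets of $X$. A coloring $c:[N]^2\to\mathbb{N}$ is $g$-regressive if $c(\{m,n\})\le g(\min\{m,n\})$ for all pairs. $N\longrightarrow(k)^2_g$ means: for every $g$-regressive coloring $c:[N]^2\to\mathbb{N}$ there is a homogeneous $B\subseteq N$ of size $k$, i.e. $c$ is constant on $[B]^2$. -}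

module Defs where

open import Data.Nat using (ℕ; zero; suc; _+_; _*_; _^_; _≤_; _<_)
open import Data.Fin using (Fin) renaming (_<_ to _<ᶠ_)
open import Data.Sum using (_⊎_)
open import Data.Product using (Σ; ∃; ∃-syntax; _×_)
open import Relation.Binary.PropositionalEquality using (_≡_)

TendsToInfinity : (ℕ → ℕ) → Set
TendsToInfinity f = ∀ M → ∃[ n₀ ] (∀ n → n₀ ≤ n → M ≤ f n)

-- ExpLe a x  :⇔  (lg x)^a ≤ x   (real lg; x ≥ 4 so lg x > 0),
-- expressed without reals: for every rational q = p/(1+s) with q < lg x
-- (i.e. 2^p < x^(1+s)) we have q^a ≤ x, i.e. p^a ≤ x * (1+s)^a.
-- Since q ↦ q^a is continuous and monotone on [0,∞) this is equivalent.
ExpLe : ℕ → ℕ → Set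
ExpLe a x = ∀ p s → 2 ^ p < x ^ suc s → p ^ a ≤ x * (suc s) ^ a

-- LeG f c x  :⇔  c ≤ g(x), where
--   g(x) = ⌊ lg x / (f(x) · lg lg x) ⌋  for x ≥ 4,   g(x) = 0 for x < 4.
-- For x ≥ 4 (so lg lg x ≥ 1 > 0):
--   c ≤ g(x) ⇔ c · f(x) · lg lg x ≤ lg x ⇔ lg ((lg x)^(c·f x)) ≤ lg x
--            ⇔ (lg x)^(c·f x) ≤ x.
LeG : (ℕ → ℕ) → ℕ → ℕ → Set
LeG f c x = (x < 4 × c ≡ 0) ⊎ (4 ≤ x × ExpLe (c * f x) x)

-- c : ℕ → ℕ → ℕ represents a coloring of [N]^2 via c m n = c({m,n}) for m < n
-- (values outside m < n < N are irrelevant).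
Regressive : (ℕ → ℕ) → ℕ → (ℕ → ℕ → ℕ) → Set
Regressive f N c = ∀ m n → m < n → n < N → LeG f (c m n) m

Homogeneous : ℕ → (ℕ → ℕ → ℕ) → ℕ → Set
Homogeneous N c k =
  Σ (Fin k → ℕ) λ b →
    (∀ i → b i < N) ×
    (∀ i j → i <ᶠ j → b i < b j) ×
    ∃[ col ] (∀ i j → i <ᶠ j → c (b i) (b j) ≡ col)

Arrow : (ℕ → ℕ) → ℕ → ℕ → Set
Arrow f N k = ∀ (c : ℕ → ℕ → ℕ) → Regressive f N c → Homogeneous N c k

{-# OPTIONS --safe #-}
module Submission where

-- Beyond the point n₀ after which f ≥ k + 2, a g-regressive colour c at a pair with minimum x
-- satisfies (lg x)^(c (k + 2)) ≤ x. On a window [A, N) with lg A ≥ p and N ≤ p^(T (k + 2))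
-- every colour is therefore below T, and the window is still long enough, (T + 2)^(Tk + 1)
-- points, for the finite Ramsey theorem with T colours: the Erdős–Rado greedy construction
-- yields an end-homogeneous sequence of length Tk + 1, in which the pigeonhole principle
-- finds k points whose labels, and hence all pair colours, agree. Take T = n₀ + 4, p = T + 2
-- and A = p^p.

open import Defs
open import Data.Bool using (true; false)
open import Data.Fin using (Fin; zero; suc; inject≤) renaming (_<_ to _<ᶠ_)
open import Data.Fin.Properties using (toℕ-inject≤)
open import Data.List using (List; []; _∷_; length; map; filter; lookup; applyUpTo)
open import Data.List.Properties using (length-map; length-applyUpTo)
open import Data.List.Membership.Propositional.Properties using (∈-lookup)
open import Data.List.Relation.Binary.Sublist.Propositional using (_⊆_; _∷_; minimum; ⊆-trans)
open import Data.List.Relation.Binary.Sublist.Propositional.Properties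
  using (filter-⊆; filter⁺; map⁺; length-mono-≤; All-resp-⊆)
open import Data.List.Relation.Unary.All as All using (All; []; _∷_)
import Data.List.Relation.Unary.All.Properties as Allₚ
open import Data.List.Relation.Unary.AllPairs using (AllPairs; []; _∷_)
import Data.List.Relation.Unary.AllPairs.Properties as AllPairsₚ
open import Data.Nat using (ℕ; zero; suc; _+_; _*_; _^_; _≤_; _<_; z≤n; s≤s; s≤s⁻¹; NonZero; _≟_; _<?_)
open import Data.Nat.Properties
open import Data.Product using (∃-syntax; _×_; _,_; proj₁; proj₂)
open import Data.Empty using (⊥-elim)
open import Data.Sum using (inj₁; inj₂)
open import Relation.Binary.PropositionalEquality using (_≡_; refl; sym; trans; cong; subst₂)
open import Relation.Nullary using (yes; no; does)
open import Relation.Unary using (Pred; Decidable)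
open import Relation.Unary.Properties using (∁?)

length-filter-∁ : ∀ {a p} {A : Set a} {P : Pred A p} (P? : Decidable P) xs →
                  length (filter P? xs) + length (filter (∁? P?) xs) ≡ length xs
length-filter-∁ P? [] = refl
length-filter-∁ P? (x ∷ xs) with does (P? x)
... | true  = cong suc (length-filter-∁ P? xs)
... | false = trans (+-suc _ _) (cong suc (length-filter-∁ P? xs))

module _ {a} {A : Set a} (col : A → ℕ) where

  pigeonhole : ∀ T m zs → All (λ z → col z < T) zs → T * m < length zs →
               ∃[ t ] t < T × m < length (filter (λ z → col z ≟ t) zs)
  pigeonhole zero    m []       []       ()
  pigeonhole zero    m (_ ∷ _)  (() ∷ _) _
  pigeonhole (suc T) m zs zs<1+T 1+T*m<|zs| with m <? length (filter (λ z → col z ≟ T) zs)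
  ... | yes m<|zsₜ| = T , n<1+n T , m<|zsₜ|
  ... | no  m≮|zsₜ| with pigeonhole T m rest rest<T T*m<|rest|
    where
    rest = filter (∁? (λ z → col z ≟ T)) zs
    rest<T : All (λ z → col z < T) rest
    rest<T = All.zipWith (λ (lt , ne) → ≤∧≢⇒< (s≤s⁻¹ lt) ne)
               (Allₚ.filter⁺ _ zs<1+T , Allₚ.all-filter _ zs)
    T*m<|rest| : T * m < length rest
    T*m<|rest| = +-cancelˡ-< m _ _ (begin-strict
      m + T * m                                   <⟨ 1+T*m<|zs| ⟩
      length zs                                   ≡⟨ sym (length-filter-∁ _ zs) ⟩
      length (filter _ zs) + length rest          ≤⟨ +-monoˡ-≤ (length rest) (≮⇒≥ m≮|zsₜ|) ⟩
      m + length rest                             ∎)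
      where open ≤-Reasoning
  ... | t , t<T , m<|restₜ| =
    t , m<n⇒m<1+n t<T ,
    <-≤-trans m<|restₜ| (length-mono-≤ (filter⁺ _ _ (λ { refl eq → eq }) (filter-⊆ _ zs)))

module _ {a r} {A : Set a} {R : A → A → Set r} where

  AllPairs-lookup : ∀ {xs} → AllPairs R xs → ∀ {i j} → i <ᶠ j → R (lookup xs i) (lookup xs j)
  AllPairs-lookup (Rx ∷ _)   {zero}  {suc j} _         = All.lookup Rx (∈-lookup j)
  AllPairs-lookup (_  ∷ Rxs) {suc i} {suc j} (s≤s i<j) = AllPairs-lookup Rxs i<j

  AllPairs-mapWithAll : ∀ {p q} {P : A → Set p} {Q : A → A → Set q} →
                        (∀ {x y} → P x → R x y → Q x y) →
                        ∀ {xs} → All P xs → AllPairs R xs → AllPairs Q xs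
  AllPairs-mapWithAll f []         []         = []
  AllPairs-mapWithAll f (Px ∷ Pxs) (Rx ∷ Rxs) = All.map (f Px) Rx ∷ AllPairs-mapWithAll f Pxs Rxs

ColouredBelow : (ℕ → ℕ → ℕ) → ℕ → List ℕ → Set
ColouredBelow c T = AllPairs (λ x y → x < y × c x y < T)

MonochromaticIn : (ℕ → ℕ → ℕ) → ℕ → List ℕ → Set
MonochromaticIn c t = AllPairs (λ x y → x < y × c x y ≡ t)

EndHomogeneous : (ℕ → ℕ → ℕ) → List (ℕ × ℕ) → Set
EndHomogeneous c = AllPairs (λ (x , t) (y , _) → x < y × c x y ≡ t)

endHomogeneous : ∀ c T L S → ColouredBelow c T S → (2 + T) ^ L ≤ length S →
  ∃[ E ] EndHomogeneous c E × All (λ (_ , t) → t < T) E × map proj₁ E ⊆ S × L ≤ length E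
endHomogeneous c T zero S _ _ = [] , [] , [] , minimum S , z≤n
endHomogeneous c T (suc L) [] [] 2+T^1+L≤0 = ⊥-elim (≤⇒≯ 2+T^1+L≤0 (m^n>0 (2 + T) (suc L)))
endHomogeneous c T (suc L) (x ∷ ys) (x<ys ∷ ys-col) 2+T^1+L≤|S|
  with pigeonhole (c x) T Q ys (All.map proj₂ x<ys) T*Q<|ys|
  where
  Q = (2 + T) ^ L
  T*Q<|ys| : T * Q < length ys
  T*Q<|ys| = s≤s⁻¹ (≤-trans (+-mono-≤ (m^n>0 (2 + T) L) (+-monoˡ-≤ (T * Q) (m^n>0 (2 + T) L)))
                            2+T^1+L≤|S|)
... | t , t<T , Q<|ysₜ|
  with endHomogeneous c T L (filter (λ y → c x y ≟ t) ys)
         (AllPairsₚ.filter⁺ _ ys-col) (<⇒≤ Q<|ysₜ|)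
... | E , E-hom , E<T , E⊆ysₜ , L≤|E| =
  (x , t) ∷ E , x-hom ∷ E-hom , t<T ∷ E<T , refl ∷ ⊆-trans E⊆ysₜ (filter-⊆ _ ys) , s≤s L≤|E|
  where
  x-hom : All (λ (y , _) → x < y × c x y ≡ t) E
  x-hom = Allₚ.map⁻ (All-resp-⊆ E⊆ysₜ
            (All.zipWith (λ ((x<y , _) , eq) → x<y , eq)
              (Allₚ.filter⁺ _ x<ys , Allₚ.all-filter _ ys)))

ramsey : ∀ c T k S → ColouredBelow c T S → (2 + T) ^ suc (T * k) ≤ length S →
         ∃[ t ] ∃[ H ] H ⊆ S × k ≤ length H × MonochromaticIn c t H
ramsey c T k S S-col bound with endHomogeneous c T (suc (T * k)) S S-col bound
... | E , E-hom , E<T , E⊆S , T*k<|E| with pigeonhole proj₂ T k E E<T T*k<|E|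
... | t , _ , k<|Eₜ| =
  t , map proj₁ Eₜ , ⊆-trans (map⁺ proj₁ (filter-⊆ _ E)) E⊆S ,
  ≤-trans (<⇒≤ k<|Eₜ|) (≤-reflexive (sym (length-map proj₁ Eₜ))) ,
  AllPairsₚ.map⁺ (AllPairs-mapWithAll (λ { refl r → r }) (Allₚ.all-filter _ E)
                                       (AllPairsₚ.filter⁺ _ E-hom))
  where Eₜ = filter (λ e → proj₂ e ≟ t) E

homogeneous-fromList : ∀ {N c k t H} → All (_< N) H → k ≤ length H → MonochromaticIn c t H →
                       Homogeneous N c k
homogeneous-fromList {N} {c} {k} {t} {H} H<N k≤|H| H-mono =
  b , (λ i → All.lookup H<N (∈-lookup (index i))) ,
  (λ _ _ i<j → proj₁ (pair i<j)) , t , (λ _ _ i<j → proj₂ (pair i<j))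
  where
  index : Fin k → Fin (length H)
  index i = inject≤ i k≤|H|
  b : Fin k → ℕ
  b i = lookup H (index i)
  pair : ∀ {i j} → i <ᶠ j → b i < b j × c (b i) (b j) ≡ t
  pair {i} {j} i<j =
    AllPairs-lookup H-mono (subst₂ _<_ (sym (toℕ-inject≤ i k≤|H|)) (sym (toℕ-inject≤ j k≤|H|)) i<j)

-- ExpLe is used only at the rational p/1, which lies below lg x because 2 ^ p < x.
LeG⇒^≤ : ∀ {f c x} p → LeG f c x → 2 ^ p < x → p ^ (c * f x) ≤ x
LeG⇒^≤ p (inj₁ (_ , refl)) 2^p<x = ≤-trans (s≤s z≤n) 2^p<x
LeG⇒^≤ {f} {c} {x} p (inj₂ (_ , lgx^≤x)) 2^p<x = begin
  p ^ (c * f x)        ≤⟨ lgx^≤x p 0 (subst₂ _<_ refl (sym (^-identityʳ x)) 2^p<x) ⟩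
  x * 1 ^ (c * f x)    ≡⟨ cong (x *_) (^-zeroˡ (c * f x)) ⟩
  x * 1                ≡⟨ *-identityʳ x ⟩
  x                    ∎
  where open ≤-Reasoning

regressive-colour< : ∀ {f N c} p T M .{{_ : NonZero p}} → Regressive f N c → N ≤ p ^ (T * M) →
                     ∀ {x y} → M ≤ f x → 2 ^ p < x → x < y → y < N → c x y < T
regressive-colour< {f} {c = c} p T M reg N≤p^TM {x} {y} M≤fx 2^p<x x<y y<N = ≰⇒> λ T≤c →
  ≤⇒≯ (≤-trans (^-monoʳ-≤ p (*-mono-≤ T≤c M≤fx)) (LeG⇒^≤ {f} {c x y} p (reg x y x<y y<N) 2^p<x))
      (<-≤-trans (<-trans x<y y<N) N≤p^TM)

+-≤-^-suc : ∀ {p e x y} → 2 ≤ p → x ≤ p ^ e → y ≤ p ^ e → x + y ≤ p ^ suc e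
+-≤-^-suc {p} {e} {x} {y} 2≤p x≤p^e y≤p^e = begin
  x + y              ≤⟨ +-mono-≤ x≤p^e y≤p^e ⟩
  p ^ e + p ^ e      ≡⟨ cong (p ^ e +_) (sym (+-identityʳ (p ^ e))) ⟩
  2 * p ^ e          ≤⟨ *-monoˡ-≤ (p ^ e) 2≤p ⟩
  p ^ suc e          ∎
  where open ≤-Reasoning

n≤n^n : ∀ n → n ≤ n ^ n
n≤n^n zero    = z≤n
n≤n^n (suc n) = begin
  suc n              ≡⟨ sym (*-identityʳ (suc n)) ⟩
  suc n * 1          ≤⟨ *-monoʳ-≤ (suc n) (m^n>0 (suc n) n) ⟩
  suc n * suc n ^ n  ∎
  where open ≤-Reasoning

window-size : ∀ {T} k → 4 ≤ T →
              (2 + T) ^ (2 + T) + (2 + T) ^ suc (T * k) ≤ (2 + T) ^ (T * (2 + k))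
window-size {T} k 4≤T = begin
  p ^ p + p ^ suc (T * k)     ≤⟨ +-≤-^-suc {p} {p + suc (T * k)} (s≤s (s≤s z≤n))
                                   (^-monoʳ-≤ p (m≤m+n p (suc (T * k))))
                                   (^-monoʳ-≤ p (m≤n+m (suc (T * k)) p)) ⟩
  p ^ suc (p + suc (T * k))   ≤⟨ ^-monoʳ-≤ p exponent ⟩
  p ^ (T * (2 + k))           ∎
  where
  open ≤-Reasoning
  p = 2 + T
  exponent : suc (p + suc (T * k)) ≤ T * (2 + k)
  exponent = begin
    3 + T + suc (T * k)  ≡⟨ +-suc (3 + T) (T * k) ⟩
    4 + T + T * k        ≤⟨ +-monoˡ-≤ (T * k) (+-monoˡ-≤ T 4≤T) ⟩
    T + T + T * k        ≡⟨ +-assoc T T (T * k) ⟩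
    T + (T + T * k)      ≡⟨ cong (T +_) (sym (*-suc T k)) ⟩
    T + T * suc k        ≡⟨ sym (*-suc T (suc k)) ⟩
    T * (2 + k)          ∎

window-arrow : ∀ {f M} T k p A .{{_ : NonZero p}} →
  (∀ {x} → A ≤ x → M ≤ f x) → 2 ^ p < A → A + (2 + T) ^ suc (T * k) ≤ p ^ (T * M) →
  Arrow f (A + (2 + T) ^ suc (T * k)) k
window-arrow {f} {M} T k p A M≤f-above-A 2^p<A N≤p^TM c reg
  with ramsey c T k (applyUpTo (A +_) R) window-coloured (≤-reflexive (sym (length-applyUpTo (A +_) R)))
  where
  R = (2 + T) ^ suc (T * k)
  window-coloured : ColouredBelow c T (applyUpTo (A +_) R)
  window-coloured = AllPairsₚ.applyUpTo⁺₁ (A +_) R λ {i} i<j j<R →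
    +-monoʳ-< A i<j ,
    regressive-colour< p T M reg N≤p^TM (M≤f-above-A (m≤m+n A i)) (<-≤-trans 2^p<A (m≤m+n A i))
      (+-monoʳ-< A i<j) (+-monoʳ-< A j<R)
... | _ , H , H⊆window , k≤|H| , H-mono =
  homogeneous-fromList (All-resp-⊆ H⊆window (Allₚ.applyUpTo⁺₁ (A +_) _ (+-monoʳ-< A))) k≤|H| H-mono

mainTheorem6 : (f : ℕ → ℕ) → (∀ n → 1 ≤ f n) → TendsToInfinity f →
    ∀ (k : ℕ) → ∃[ N ] Arrow f N k
mainTheorem6 f _ f→∞ k =
  _ , window-arrow T k p (p ^ p)
        (λ p^p≤x → proj₂ (f→∞ M) _ (≤-trans (≤-trans (m≤n+m n₀ 6) (n≤n^n p)) p^p≤x))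
        (^-monoˡ-< p (s≤s (s≤s (s≤s z≤n))))
        (window-size k (m≤m+n 4 n₀))
  where
  M = 2 + k
  n₀ = proj₁ (f→∞ M)
  T = 4 + n₀
  p = 2 + T
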